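{- Let $B$ be a nontrivial Boolean algebra and $M(B)$ the join semilattice of all modal operators on $B$, with pointwise join $(f\lor g)(x)=f(x)+g(x)$. Then $M(B)$ is a complete semilattice (every nonempty subset has a join) if and only if $B$ is a complete Boolean algebra.
   Context: A modal operator on $B$ is a map $f:B\to B$ with $f(0)=0$ and $f(x+y)=f(x)+f(y)$ for all $x,y\in B$. $M(B)$ is ordered by $f\le g$ iff $f(x)\le g(x)$ for all $x$. -}

module Defs where

open import Level using (Level; _⊔_)
open import Data.Product using (Σ; ∃; _×_)
open import Relation.Nullary using (¬_)
open import Algebra.Lattice.Bundles using (BooleanAlgebra)

module _ {c ℓ : Level} (B : BooleanAlgebra c ℓ) where
  open BooleanAlgebra B renaming (¬_ to compl)

  _≤B_ : Carrier → Carrier → Set ℓ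
  x ≤B y = (x ∨ y) ≈ y

  Nontrivial : Set ℓ
  Nontrivial = ¬ (⊤ ≈ ⊥)

  SubsetB : Set (Level.suc (c ⊔ ℓ))
  SubsetB = Carrier → Set (c ⊔ ℓ)

  IsJoinB : SubsetB → Carrier → Set (c ⊔ ℓ)
  IsJoinB S j = (∀ s → S s → s ≤B j) × (∀ u → (∀ s → S s → s ≤B u) → j ≤B u)

  IsComplete : Set (Level.suc (c ⊔ ℓ))
  IsComplete = (S : SubsetB) → ∃ λ j → IsJoinB S j

  record ModalOp : Set (c ⊔ ℓ) where
    field
      op       : Carrier → Carrier
      op-cong  : ∀ {x y} → x ≈ y → op x ≈ op y
      op-zero  : op ⊥ ≈ ⊥
      op-join  : ∀ x y → op (x ∨ y) ≈ (op x ∨ op y)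
  open ModalOp public

  _≤M_ : ModalOp → ModalOp → Set (c ⊔ ℓ)
  f ≤M g = ∀ x → op f x ≤B op g x

  SubsetM : Set (Level.suc (c ⊔ ℓ))
  SubsetM = ModalOp → Set (c ⊔ ℓ)

  IsJoinM : SubsetM → ModalOp → Set (c ⊔ ℓ)
  IsJoinM P j = (∀ f → P f → f ≤M j) × (∀ u → (∀ f → P f → f ≤M u) → j ≤M u)

  MIsCompleteSemilattice : Set (Level.suc (c ⊔ ℓ))
  MIsCompleteSemilattice = (P : SubsetM) → (∃ λ f → P f) → ∃ λ j → IsJoinM P j

-- If B is complete, the pointwise join of any family of modal operators is again
-- modal, since joins in B commute with binary joins and preserve ⊥. Conversely,
-- for S ⊆ B the join j in M(B) of the operators u ∧ _ (u ∈ S) satisfies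
-- j ⊤ = ⋁ S: every u ∧ _ lies below j, and for an upper bound v of S the operator
-- v ∧ _ bounds the family, so j ⊤ ≤ v ∧ ⊤ = v.
module Submission where

open import Defs
open import Level using (Level)
open import Function.Bundles using (_⇔_; mk⇔)
open import Algebra.Lattice.Bundles using (BooleanAlgebra)
open import Data.Product using (∃; _×_; _,_; proj₁; proj₂)
open import Data.Sum using (_⊎_; inj₁; inj₂)
import Algebra.Lattice.Properties.BooleanAlgebra as BooleanAlgebraProperties
import Relation.Binary.Reasoning.Setoid as SetoidReasoning

module _ {c ℓ : Level} (B : BooleanAlgebra c ℓ) where
  open BooleanAlgebra B
  open BooleanAlgebraProperties B
  open SetoidReasoning setoid

  private
    _≤_ : Carrier → Carrier → Set ℓ
    _≤_ = _≤B_ B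

  ≤-reflexive : ∀ {x y} → x ≈ y → x ≤ y
  ≤-reflexive {x} {y} x≈y = trans (∨-congʳ x≈y) (∨-idem y)

  ≤-trans : ∀ {x y z} → x ≤ y → y ≤ z → x ≤ z
  ≤-trans {x} {y} {z} x≤y y≤z = begin
    x ∨ z       ≈⟨ ∨-congˡ y≤z ⟨
    x ∨ (y ∨ z) ≈⟨ ∨-assoc x y z ⟨
    (x ∨ y) ∨ z ≈⟨ ∨-congʳ x≤y ⟩
    y ∨ z       ≈⟨ y≤z ⟩
    z           ∎

  ≤-antisym : ∀ {x y} → x ≤ y → y ≤ x → x ≈ y
  ≤-antisym {x} {y} x≤y y≤x = trans (sym y≤x) (trans (∨-comm y x) x≤y)

  ⊥≤ : ∀ x → ⊥ ≤ x
  ⊥≤ = ∨-identityˡ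

  x≤x∨y : ∀ x y → x ≤ (x ∨ y)
  x≤x∨y x y = trans (sym (∨-assoc x x y)) (∨-congʳ (∨-idem x))

  y≤x∨y : ∀ x y → y ≤ (x ∨ y)
  y≤x∨y x y = ≤-trans (x≤x∨y y x) (≤-reflexive (∨-comm y x))

  ∨-least : ∀ {x y z} → x ≤ z → y ≤ z → (x ∨ y) ≤ z
  ∨-least {x} {y} {z} x≤z y≤z = trans (∨-assoc x y z) (trans (∨-congˡ y≤z) x≤z)

  ∨-mono-≤ : ∀ {x y u v} → x ≤ u → y ≤ v → (x ∨ y) ≤ (u ∨ v)
  ∨-mono-≤ x≤u y≤v = ∨-least (≤-trans x≤u (x≤x∨y _ _)) (≤-trans y≤v (y≤x∨y _ _))

  ∧-monoˡ-≤ : ∀ {x y} z → x ≤ y → (x ∧ z) ≤ (y ∧ z)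
  ∧-monoˡ-≤ {x} {y} z x≤y = trans (sym (∧-distribʳ-∨ z x y)) (∧-congʳ x≤y)

  op-mono : (f : ModalOp B) → ∀ {x y} → x ≤ y → op f x ≤ op f y
  op-mono f {x} {y} x≤y = trans (sym (op-join f x y)) (op-cong f x≤y)

  meetOp : Carrier → ModalOp B
  meetOp u = record
    { op      = u ∧_
    ; op-cong = ∧-congˡ
    ; op-zero = ∧-zeroʳ u
    ; op-join = ∧-distribˡ-∨ u
    }

  meetOp-mono : ∀ {u v} → u ≤ v → _≤M_ B (meetOp u) (meetOp v)
  meetOp-mono u≤v x = ∧-monoˡ-≤ x u≤v

  -- Adjoining ⊥ to S makes the family nonempty without changing its join.
  MeetOpsOf : SubsetB B → SubsetM B
  MeetOpsOf S f = ∃ λ s → (S s ⊎ s ≈ ⊥) × (∀ x → op f x ≈ (s ∧ x))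

  completeM⇒complete : MIsCompleteSemilattice B → IsComplete B
  completeM⇒complete completeM S = op j ⊤ , upper , least
    where
    joinM : ∃ λ j → IsJoinM B (MeetOpsOf S) j
    joinM = completeM (MeetOpsOf S) (meetOp ⊥ , ⊥ , inj₂ refl , λ _ → refl)

    j : ModalOp B
    j = proj₁ joinM

    upper : ∀ s → S s → s ≤ op j ⊤
    upper s s∈S = ≤-trans (≤-reflexive (sym (∧-identityʳ s)))
                          (proj₁ (proj₂ joinM) (meetOp s) (s , inj₁ s∈S , λ _ → refl) ⊤)

    least : ∀ u → (∀ s → S s → s ≤ u) → op j ⊤ ≤ u
    least u u-ub = ≤-trans (proj₂ (proj₂ joinM) (meetOp u) meetOp-ub ⊤)
                           (≤-reflexive (∧-identityʳ u))
      where
      s≤u : ∀ {s} → S s ⊎ s ≈ ⊥ → s ≤ u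
      s≤u (inj₁ s∈S) = u-ub _ s∈S
      s≤u (inj₂ s≈⊥) = ≤-trans (≤-reflexive s≈⊥) (⊥≤ u)

      meetOp-ub : ∀ f → MeetOpsOf S f → _≤M_ B f (meetOp u)
      meetOp-ub f (s , s∈S⊥ , f≈s∧) x =
        ≤-trans (≤-reflexive (f≈s∧ x)) (meetOp-mono (s≤u s∈S⊥) x)

  module PointwiseJoin (complete : IsComplete B) (P : SubsetM B) where

    ValuesAt : Carrier → SubsetB B
    ValuesAt x b = ∃ λ f → P f × b ≈ op f x

    ⋁ : Carrier → Carrier
    ⋁ x = proj₁ (complete (ValuesAt x))

    ⋁-upper : ∀ {f} → P f → ∀ x → op f x ≤ ⋁ x
    ⋁-upper {f} f∈P x = proj₁ (proj₂ (complete (ValuesAt x))) (op f x) (f , f∈P , refl)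

    ⋁-least : ∀ x u → (∀ f → P f → op f x ≤ u) → ⋁ x ≤ u
    ⋁-least x u bound = proj₂ (proj₂ (complete (ValuesAt x))) u
      λ { b (f , f∈P , b≈fx) → ≤-trans (≤-reflexive b≈fx) (bound f f∈P) }

    ⋁-mono : ∀ {x y} → x ≤ y → ⋁ x ≤ ⋁ y
    ⋁-mono {x} {y} x≤y = ⋁-least x (⋁ y) λ f f∈P → ≤-trans (op-mono f x≤y) (⋁-upper f∈P y)

    ⋁-join : ∀ x y → ⋁ (x ∨ y) ≈ (⋁ x ∨ ⋁ y)
    ⋁-join x y = ≤-antisym
      (⋁-least (x ∨ y) (⋁ x ∨ ⋁ y) λ f f∈P →
        ≤-trans (≤-reflexive (op-join f x y)) (∨-mono-≤ (⋁-upper f∈P x) (⋁-upper f∈P y)))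
      (∨-least (⋁-mono (x≤x∨y x y)) (⋁-mono (y≤x∨y x y)))

    ⋁-zero : ⋁ ⊥ ≈ ⊥
    ⋁-zero = ≤-antisym (⋁-least ⊥ ⊥ λ f _ → ≤-reflexive (op-zero f)) (⊥≤ (⋁ ⊥))

    ⋁-modalOp : ModalOp B
    ⋁-modalOp = record
      { op      = ⋁
      ; op-cong = λ x≈y → ≤-antisym (⋁-mono (≤-reflexive x≈y)) (⋁-mono (≤-reflexive (sym x≈y)))
      ; op-zero = ⋁-zero
      ; op-join = ⋁-join
      }

    ⋁-isJoinM : IsJoinM B P ⋁-modalOp
    ⋁-isJoinM = (λ f f∈P → ⋁-upper f∈P)
              , λ u u-ub x → ⋁-least x (op u x) λ f f∈P → u-ub f f∈P x

  complete⇒completeM : IsComplete B → MIsCompleteSemilattice B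
  complete⇒completeM complete P _ = ⋁-modalOp , ⋁-isJoinM
    where open PointwiseJoin complete P

mainTheorem2 : {c ℓ : Level} (B : BooleanAlgebra c ℓ) → Nontrivial B →
    MIsCompleteSemilattice B ⇔ IsComplete B
mainTheorem2 B _ = mk⇔ (completeM⇒complete B) (complete⇒completeM B)
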